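{- Let $p<q<r$ be primes and $N>1$ an integer whose divisors $1=d_1<d_2<\cdots$ satisfy $d_2=p$, $d_3=q$, $d_4=r$, $d_5=p^2$, all in $S'_N$. Suppose $N$ is small recurrent with $U(p,q,a,b)$ for integers $a,b$. Then: (i) $\gcd(a,b)=1$ and $p\nmid a$; (ii) $\gcd(b,d_i)=1$ for all $d_i\in S'_N$; (iii) $\gcd(d_i,d_{i+1})=1$ for all $d_i,d_{i+1}\in S'_N$; (iv) for $d_i\in S'_N$, $p\mid d_i$ if and only if $i\equiv 2\pmod 3$.
   Context: For $N>1$ let $1=d_1<d_2<\cdots<d_{\tau(N)}=N$ be its divisors and $S'_N=\{d:1<d<\sqrt N,\ d\mid N\}=\{d_2,d_3,\ldots\}$. "$N$ is small recurrent with $U(p,q,a,b)$" means $d_2=p$, $d_3=q$ and $d_i=ad_{i-1}+bd_{i-2}$ for every $i\ge4$ with $d_i\in S'_N$. -}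

module Defs where

open import Data.Nat using (ℕ; suc; _<_; _*_; _∸_; _≥_)
open import Data.Nat.Divisibility using (_∣_; _∣?_)
open import Data.List using (List; filter; applyUpTo; length)
open import Data.Integer as ℤ using (ℤ; +_)
open import Data.Product using (_×_; ∃₂)
open import Relation.Binary.PropositionalEquality using (_≡_)

divisorsUpTo : ℕ → ℕ → List ℕ
divisorsUpTo N x = filter (_∣? N) (applyUpTo suc x)

-- IsDiv N i x  :  x = d_i, the i-th smallest divisor of N (1-indexed: d_1 = 1)
IsDiv : ℕ → ℕ → ℕ → Set
IsDiv N i x = x ∣ N × length (divisorsUpTo N x) ≡ i

-- x ∈ S'_N  :  x ∣ N, 1 < x < √N  (x < √N  ⇔  x * x < N)
InS' : ℕ → ℕ → Set
InS' N x = x ∣ N × 1 < x × x * x < N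

SmallRecurrent : ℕ → ℕ → ℕ → ℤ → ℤ → Set
SmallRecurrent N p q a b =
  IsDiv N 2 p × IsDiv N 3 q ×
  (∀ i x → i ≥ 4 → IsDiv N i x → InS' N x →
    ∃₂ λ y z → IsDiv N (i ∸ 1) y × IsDiv N (i ∸ 2) z ×
      (+ x ≡ a ℤ.* (+ y) ℤ.+ b ℤ.* (+ z)))

-- The instances r = a q + b p and p² = a r + b q
-- show that a prime dividing a and b divides both r and p, and that p ∤ a, p ∤ b, q ∤ b. Any other
-- prime s ∈ S'_N is some d_i with i ≥ 4, so s = a d' + b d'' with 1 < d' < s; if s ∣ b then s ∣ a d',
-- impossible as s ∤ a (a and b are coprime) and s ∤ d'. Hence b is coprime to every element of S'_N,
-- and consecutive divisors are coprime by induction: a common prime of d_i and d_(i+1) divides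
-- b d_(i-1). Finally, two steps of the recurrence give d_i = (a² + b) d_(i-2) + ab d_(i-3), and
-- p² = (a² + b) q + ab p forces p ∣ a² + b while p ∤ ab, so p ∣ d_i iff p ∣ d_(i-3); the pattern
-- p, q, r then repeats with period 3.
module Submission where

open import Defs
open import Data.Nat using (ℕ; suc; _<_; _*_; _%_)
open import Data.Nat.Primality using (Prime)
open import Data.Nat.GCD using (gcd)
open import Data.Integer as ℤ using (ℤ; +_; ∣_∣)
open import Data.Integer.GCD renaming (gcd to gcdℤ)
open import Data.Integer.Divisibility renaming (_∣_ to _∣ℤ_)
open import Data.Nat.Divisibility using (_∣_)
open import Data.Product using (_×_)
open import Function.Bundles using (_⇔_)
open import Relation.Nullary using (¬_)
open import Relation.Binary.PropositionalEquality using (_≡_)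

open import Data.Nat
  using (_≤_; _≤′_; ≤′-refl; ≤′-step; _+_; z≤n; s≤s; z<s; 2+; >-nonZero; nonTrivial⇒n>1)
open import Data.Nat.Properties
open import Data.Nat.Divisibility
  using (_∣?_; ∣-refl; ∣-trans; _∣0; 1∣_; m∣m*n; ∣⇒≤; >⇒∤)
open import Data.Nat.DivMod using ([m+n]%n≡m%n)
open import Data.Nat.Primality
  using (¬prime[1]; prime[2]; prime⇒nonTrivial; prime⇒irreducible; euclidsLemma)
open import Data.Nat.Primality.Factorisation using (factorise)
open import Data.Nat.Coprimality using (Coprime; coprime⇒gcd≡1)
import Data.Integer.Properties as ℤ using (abs-*; +-comm)
import Data.Integer.Divisibility.Signed as Signed
open import Data.Integer.Solver using (module +-*-Solver)
open import Data.List using ([]; _∷_; [_]; _++_; filter; applyUpTo; length)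
open import Data.Nat.ListAction using (product)
open import Data.List.Properties
  using (applyUpTo-∷ʳ; filter-++; length-++; filter-accept; length-filter; length-applyUpTo)
open import Data.List.Relation.Unary.All using (_∷_)
open import Data.Product using (∃; ∃₂; _,_; proj₁; proj₂)
open import Data.Sum using (_⊎_; inj₁; inj₂; [_,_]′)
open import Data.Empty using (⊥; ⊥-elim)
open import Function.Base using (_∘_; id; const)
open import Function.Bundles using (mk⇔; Equivalence)
import Function.Related.Propositional as Related
open import Relation.Nullary using (contradiction)
open import Relation.Binary.PropositionalEquality
  using (refl; sym; trans; cong; subst; module ≡-Reasoning)
open import Relation.Binary.Definitions using (tri<; tri≈; tri>)

open Equivalence using (to; from)

private
  variable
    i j m n s x y : ℕ

module DivisorRank (N : ℕ) where

  rank : ℕ → ℕ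
  rank x = length (divisorsUpTo N x)

  rank-suc : ∀ x → rank (suc x) ≡ rank x + length (filter (_∣? N) [ suc x ])
  rank-suc x = begin
    length (filter (_∣? N) (applyUpTo suc (suc x)))
      ≡⟨ cong (length ∘ filter (_∣? N)) (applyUpTo-∷ʳ suc x) ⟨
    length (filter (_∣? N) (applyUpTo suc x ++ [ suc x ]))
      ≡⟨ cong length (filter-++ (_∣? N) (applyUpTo suc x) [ suc x ]) ⟩
    length (divisorsUpTo N x ++ filter (_∣? N) [ suc x ])
      ≡⟨ length-++ (divisorsUpTo N x) ⟩
    rank x + length (filter (_∣? N) [ suc x ]) ∎
    where open ≡-Reasoning

  rank≤rank-suc : ∀ x → rank x ≤ rank (suc x)
  rank≤rank-suc x = ≤-trans (m≤m+n (rank x) _) (≤-reflexive (sym (rank-suc x)))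

  rank-suc-∣ : suc x ∣ N → rank (suc x) ≡ suc (rank x)
  rank-suc-∣ {x} suc-x∣N = begin
    rank (suc x)                                 ≡⟨ rank-suc x ⟩
    rank x + length (filter (_∣? N) [ suc x ])
      ≡⟨ cong (λ l → rank x + length l) (filter-accept (_∣? N) suc-x∣N) ⟩
    rank x + 1                                   ≡⟨ +-comm (rank x) 1 ⟩
    suc (rank x)                                 ∎
    where open ≡-Reasoning

  rank≤ : ∀ x → rank x ≤ x
  rank≤ x = ≤-trans (length-filter (_∣? N) (applyUpTo suc x)) (≤-reflexive (length-applyUpTo suc x))

  rank-mono-≤ : x ≤ y → rank x ≤ rank y
  rank-mono-≤ = go ∘ ≤⇒≤′
    where
    go : x ≤′ y → rank x ≤ rank y
    go ≤′-refl         = ≤-refl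
    go (≤′-step x≤′y) = ≤-trans (go x≤′y) (rank≤rank-suc _)

  rank-<-divisor : y ∣ N → x < y → rank x < rank y
  rank-<-divisor {suc y} y∣N (s≤s x≤y) =
    ≤-trans (s≤s (rank-mono-≤ x≤y)) (≤-reflexive (sym (rank-suc-∣ y∣N)))

  IsDiv-unique : IsDiv N i x → IsDiv N i y → x ≡ y
  IsDiv-unique {x = x} {y = y} (x∣N , refl) (y∣N , rank-y≡rank-x) with <-cmp x y
  ... | tri< x<y _ _ = contradiction rank-y≡rank-x (>⇒≢ (rank-<-divisor y∣N x<y))
  ... | tri≈ _ x≡y _ = x≡y
  ... | tri> _ _ y<x = contradiction rank-y≡rank-x (<⇒≢ (rank-<-divisor x∣N y<x))

  IsDiv-<-mono : IsDiv N i x → IsDiv N j y → i < j → x < y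
  IsDiv-<-mono (_ , refl) (_ , refl) i<j = ≰⇒> (<⇒≱ i<j ∘ rank-mono-≤)

  1<⇒index≥2 : IsDiv N i x → 1 < x → 2 ≤ i
  1<⇒index≥2 {x = x} (x∣N , refl) 1<x =
    subst (_< rank x) (rank-suc-∣ {0} (1∣ N)) (rank-<-divisor x∣N 1<x)

  index≥2⇒1< : IsDiv N i x → 2 ≤ i → 1 < x
  index≥2⇒1< {x = x} (_ , refl) 2≤i = ≤-trans 2≤i (rank≤ x)

  InS'-≤ : InS' N x → y ∣ N → 1 < y → y ≤ x → InS' N y
  InS'-≤ (_ , _ , x*x<N) y∣N 1<y y≤x = y∣N , 1<y , ≤-<-trans (*-mono-≤ y≤x y≤x) x*x<N

  InS'⇒index≥2 : IsDiv N i x → InS' N x → 2 ≤ i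
  InS'⇒index≥2 dx (_ , 1<x , _) = 1<⇒index≥2 dx 1<x

  InS'-earlier : IsDiv N i x → InS' N x → IsDiv N j y → 2 ≤ j → j < i → InS' N y
  InS'-earlier dx x∈S' dy 2≤j j<i =
    InS'-≤ x∈S' (proj₁ dy) (index≥2⇒1< dy 2≤j) (<⇒≤ (IsDiv-<-mono dy dx j<i))

prime⇒1< : Prime s → 1 < s
prime⇒1< {s} s-prime = nonTrivial⇒n>1 s {{prime⇒nonTrivial s-prime}}

prime∣prime⇒≡ : Prime s → Prime n → s ∣ n → s ≡ n
prime∣prime⇒≡ s-prime n-prime s∣n with prime⇒irreducible n-prime s∣n
... | inj₁ refl = ⊥-elim (¬prime[1] s-prime)
... | inj₂ s≡n = s≡n

prime-<⇒∤ : Prime n → 1 < m → m < n → ¬ m ∣ n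
prime-<⇒∤ n-prime 1<m m<n m∣n with prime⇒irreducible n-prime m∣n
... | inj₁ m≡1 = >⇒≢ 1<m m≡1
... | inj₂ m≡n = <⇒≢ m<n m≡n

prime-factor : ∀ n → 1 < n → ∃ λ s → Prime s × s ∣ n
prime-factor n 1<n with factorise n {{>-nonZero (<-trans z<s 1<n)}}
... | record { factors = [] ; isFactorisation = n≡1 } = contradiction n≡1 (>⇒≢ 1<n)
... | record { factors = s ∷ ss ; isFactorisation = n≡s*∏ss ; factorsPrime = s-prime ∷ _ } =
  s , s-prime , subst (s ∣_) (sym n≡s*∏ss) (m∣m*n (product ss))

NoCommonPrime : ℕ → ℕ → Set
NoCommonPrime m n = ∀ {s} → Prime s → s ∣ m → s ∣ n → ⊥

noCommonPrime⇒gcd≡1 : NoCommonPrime m n → gcd m n ≡ 1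
noCommonPrime⇒gcd≡1 {m} {n} noCommon = coprime⇒gcd≡1 coprime
  where
  coprime : Coprime m n
  coprime {0}    (0∣m , 0∣n) = ⊥-elim (noCommon prime[2] (∣-trans (2 ∣0) 0∣m) (∣-trans (2 ∣0) 0∣n))
  coprime {1}    _           = refl
  coprime {2+ d} (d∣m , d∣n) with prime-factor (2+ d) (s≤s (s≤s z≤n))
  ... | s , s-prime , s∣d = ⊥-elim (noCommon s-prime (∣-trans s∣d d∣m) (∣-trans s∣d d∣n))

-- Divisibility on ℤ here is the unsigned one; its additive lemmas exist only for the signed variant.
signed : ∀ {k} z → + k ∣ℤ z → + k Signed.∣ z
signed {k} z = Signed.∣ᵤ⇒∣ {+ k} {z}

-- The summands are explicit since ℤ._*_ unfolds, so u and v cannot be inferred from the equation.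
∣-+-⇔ʳ : ∀ {k x} u v → x ≡ u ℤ.+ v → + k ∣ℤ u → (+ k ∣ℤ x ⇔ + k ∣ℤ v)
∣-+-⇔ʳ u v refl k∣u = mk⇔
  (λ k∣u+v → Signed.∣⇒∣ᵤ (Signed.∣m+n∣m⇒∣n (signed (u ℤ.+ v) k∣u+v) (signed u k∣u)))
  (λ k∣v → Signed.∣⇒∣ᵤ (Signed.∣m∣n⇒∣m+n (signed u k∣u) (signed v k∣v)))

∣-+-⇔ˡ : ∀ {k x} u v → x ≡ u ℤ.+ v → + k ∣ℤ v → (+ k ∣ℤ x ⇔ + k ∣ℤ u)
∣-+-⇔ˡ u v x≡u+v = ∣-+-⇔ʳ v u (trans x≡u+v (ℤ.+-comm u v))

∣ℤm⇒∣ℤm*n : ∀ {k} m n → + k ∣ℤ m → + k ∣ℤ m ℤ.* n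
∣ℤm⇒∣ℤm*n m n k∣m = Signed.∣⇒∣ᵤ (Signed.∣m⇒∣m*n n (signed m k∣m))

∣ℤn⇒∣ℤm*n : ∀ {k} m n → + k ∣ℤ n → + k ∣ℤ m ℤ.* n
∣ℤn⇒∣ℤm*n m n k∣n = Signed.∣⇒∣ᵤ (Signed.∣n⇒∣m*n m (signed n k∣n))

euclidsLemmaℤ : ∀ {k} m n → Prime k → + k ∣ℤ m ℤ.* n → + k ∣ℤ m ⊎ + k ∣ℤ n
euclidsLemmaℤ {k} m n k-prime k∣mn = euclidsLemma ∣ m ∣ ∣ n ∣ k-prime (subst (k ∣_) (ℤ.abs-* m n) k∣mn)

prime∤⇒∣ℤm*n⇔∣ℤn : ∀ {k} m n → Prime k → ¬ + k ∣ℤ m → (+ k ∣ℤ m ℤ.* n ⇔ + k ∣ℤ n)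
prime∤⇒∣ℤm*n⇔∣ℤn m n k-prime k∤m =
  mk⇔ ([ ⊥-elim ∘ k∤m , id ]′ ∘ euclidsLemmaℤ m n k-prime) (∣ℤn⇒∣ℤm*n m n)

second-order-recurrence : ∀ a b z w {x y : ℤ} →
  x ≡ a ℤ.* y ℤ.+ b ℤ.* z → y ≡ a ℤ.* z ℤ.+ b ℤ.* w →
  x ≡ (a ℤ.* a ℤ.+ b) ℤ.* z ℤ.+ (a ℤ.* b) ℤ.* w
second-order-recurrence a b z w {x} {y} x≡ay+bz y≡az+bw = begin
  x                                        ≡⟨ x≡ay+bz ⟩
  a ℤ.* y ℤ.+ b ℤ.* z                      ≡⟨ cong (λ t → a ℤ.* t ℤ.+ b ℤ.* z) y≡az+bw ⟩
  a ℤ.* (a ℤ.* z ℤ.+ b ℤ.* w) ℤ.+ b ℤ.* z  ≡⟨ expand a b z w ⟩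
  (a ℤ.* a ℤ.+ b) ℤ.* z ℤ.+ (a ℤ.* b) ℤ.* w ∎
  where
  open ≡-Reasoning
  open +-*-Solver
  expand : ∀ a b z w →
           a ℤ.* (a ℤ.* z ℤ.+ b ℤ.* w) ℤ.+ b ℤ.* z ≡ (a ℤ.* a ℤ.+ b) ℤ.* z ℤ.+ (a ℤ.* b) ℤ.* w
  expand = solve 4 (λ a b z w → a :* (a :* z :+ b :* w) :+ b :* z := (a :* a :+ b) :* z :+ (a :* b) :* w)
                   refl

[3+n]%3≡n%3 : ∀ n → (3 + n) % 3 ≡ n % 3
[3+n]%3≡n%3 n = trans (cong (_% 3) (+-comm 3 n)) ([m+n]%n≡m%n n 3)

module SmallRecurrence
  {N p q r : ℕ} {a b : ℤ}
  (p-prime : Prime p) (q-prime : Prime q) (r-prime : Prime r) (p<q : p < q) (q<r : q < r)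
  (d₂ : IsDiv N 2 p) (d₃ : IsDiv N 3 q) (d₄ : IsDiv N 4 r) (d₅ : IsDiv N 5 (p * p))
  (r∈S' : InS' N r) (p²∈S' : InS' N (p * p))
  (small-recurrent : SmallRecurrent N p q a b)
  where

  open DivisorRank N

  predecessors : ∀ k {x} → IsDiv N (4 + k) x → InS' N x →
                 ∃₂ λ y z → IsDiv N (3 + k) y × IsDiv N (2 + k) z × InS' N y × InS' N z
  predecessors k dx x∈S' with proj₂ (proj₂ small-recurrent) (4 + k) _ (m≤m+n 4 k) dx x∈S'
  ... | y , z , dy , dz , _ =
    y , z , dy , dz ,
    InS'-earlier dx x∈S' dy (s≤s (s≤s z≤n)) ≤-refl , InS'-earlier dx x∈S' dz (s≤s (s≤s z≤n)) (n≤1+n _)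

  recurrence : ∀ k {x y z} → IsDiv N (4 + k) x → InS' N x → IsDiv N (3 + k) y → IsDiv N (2 + k) z →
               + x ≡ a ℤ.* + y ℤ.+ b ℤ.* + z
  recurrence k dx x∈S' dy dz with proj₂ (proj₂ small-recurrent) (4 + k) _ (m≤m+n 4 k) dx x∈S'
  ... | _ , _ , dy′ , dz′ , x≡ay′+bz′ with IsDiv-unique dy′ dy | IsDiv-unique dz′ dz
  ...   | refl | refl = x≡ay′+bz′

  recurrence₂ : ∀ k {x} → IsDiv N (5 + k) x → InS' N x →
                ∃₂ λ z w → IsDiv N (2 + k) w × InS' N w ×
                           + x ≡ (a ℤ.* a ℤ.+ b) ℤ.* + z ℤ.+ (a ℤ.* b) ℤ.* + w
  recurrence₂ k dx x∈S' with predecessors (suc k) dx x∈S'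
  ... | y , z , dy , dz , y∈S' , _ with predecessors k dy y∈S'
  ...   | _ , w , _ , dw , _ , w∈S' =
    z , w , dw , w∈S' ,
    second-order-recurrence a b (+ z) (+ w) (recurrence (suc k) dx x∈S' dy dz) (recurrence k dy y∈S' dz dw)

  p∤q : ¬ p ∣ q
  p∤q = prime-<⇒∤ q-prime (prime⇒1< p-prime) p<q

  p∤r : ¬ p ∣ r
  p∤r = prime-<⇒∤ r-prime (prime⇒1< p-prime) (<-trans p<q q<r)

  q∤r : ¬ q ∣ r
  q∤r = prime-<⇒∤ r-prime (prime⇒1< q-prime) q<r

  r≡aq+bp : + r ≡ a ℤ.* + q ℤ.+ b ℤ.* + p
  r≡aq+bp = recurrence 0 d₄ r∈S' d₃ d₂

  p²≡ar+bq : + (p * p) ≡ a ℤ.* + r ℤ.+ b ℤ.* + q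
  p²≡ar+bq = recurrence 1 d₅ p²∈S' d₄ d₃

  a-b-noCommonPrime : NoCommonPrime ∣ a ∣ ∣ b ∣
  a-b-noCommonPrime {s} s-prime s∣a s∣b = p∤r (subst (_∣ r) s≡p (divides-combination r≡aq+bp))
    where
    divides-combination : ∀ {x y z} → + x ≡ a ℤ.* + y ℤ.+ b ℤ.* + z → s ∣ x
    divides-combination {y = y} {z} x≡ay+bz =
      from (∣-+-⇔ʳ (a ℤ.* + y) (b ℤ.* + z) x≡ay+bz (∣ℤm⇒∣ℤm*n a (+ y) s∣a)) (∣ℤm⇒∣ℤm*n b (+ z) s∣b)
    s≡p : s ≡ p
    s≡p = prime∣prime⇒≡ s-prime p-prime
            ([ id , id ]′ (euclidsLemma p p s-prime (divides-combination p²≡ar+bq)))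

  p∤a : ¬ + p ∣ℤ a
  p∤a p∣a = p∤r (from (∣-+-⇔ʳ (a ℤ.* + q) (b ℤ.* + p) r≡aq+bp (∣ℤm⇒∣ℤm*n a (+ q) p∣a))
                       (∣ℤn⇒∣ℤm*n b (+ p) ∣-refl))

  p∤b : ¬ + p ∣ℤ b
  p∤b p∣b = [ p∤a , p∤r ]′ (euclidsLemmaℤ a (+ r) p-prime p∣ar)
    where
    p∣ar : + p ∣ℤ a ℤ.* + r
    p∣ar = to (∣-+-⇔ˡ (a ℤ.* + r) (b ℤ.* + q) p²≡ar+bq (∣ℤm⇒∣ℤm*n b (+ q) p∣b)) (m∣m*n p)

  q∤b : ¬ + q ∣ℤ b
  q∤b q∣b = q∤r (from (∣-+-⇔ʳ (a ℤ.* + q) (b ℤ.* + p) r≡aq+bp (∣ℤn⇒∣ℤm*n a (+ q) ∣-refl))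
                       (∣ℤm⇒∣ℤm*n b (+ p) q∣b))

  S'-prime∤b : ∀ i {s} → Prime s → IsDiv N i s → InS' N s → ¬ + s ∣ℤ b
  S'-prime∤b 0 _ ds s∈S' = contradiction (InS'⇒index≥2 ds s∈S') λ ()
  S'-prime∤b 1 _ ds s∈S' = contradiction (InS'⇒index≥2 ds s∈S') λ { (s≤s ()) }
  S'-prime∤b 2 _ ds _ rewrite IsDiv-unique ds d₂ = p∤b
  S'-prime∤b 3 _ ds _ rewrite IsDiv-unique ds d₃ = q∤b
  S'-prime∤b (suc (suc (suc (suc k)))) {s} s-prime ds s∈S' s∣b with predecessors k ds s∈S'
  ... | y , z , dy , dz , _ =
    [ (λ s∣a → a-b-noCommonPrime s-prime s∣a s∣b) , s∤y ]′ (euclidsLemmaℤ a (+ y) s-prime s∣ay)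
    where
    s∣ay : + s ∣ℤ a ℤ.* + y
    s∣ay = to (∣-+-⇔ˡ (a ℤ.* + y) (b ℤ.* + z) (recurrence k ds s∈S' dy dz) (∣ℤm⇒∣ℤm*n b (+ z) s∣b))
              ∣-refl
    s∤y : ¬ s ∣ y
    s∤y = >⇒∤ {{>-nonZero (<-trans z<s (index≥2⇒1< dy (s≤s (s≤s z≤n))))}} (IsDiv-<-mono dy ds ≤-refl)

  b-noCommonPrime : InS' N x → NoCommonPrime ∣ b ∣ x
  b-noCommonPrime x∈S'@(x∣N , 1<x , _) {s} s-prime s∣b s∣x =
    S'-prime∤b _ s-prime (s∣N , refl) s∈S' s∣b
    where
    s∣N = ∣-trans s∣x x∣N
    s∈S' = InS'-≤ x∈S' s∣N (prime⇒1< s-prime) (∣⇒≤ {{>-nonZero (<-trans z<s 1<x)}} s∣x)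

  ConsecutiveCoprime : ℕ → Set
  ConsecutiveCoprime i =
    ∀ {x y} → IsDiv N i x → IsDiv N (suc i) y → InS' N x → InS' N y → NoCommonPrime x y

  consecutiveCoprime-step : ∀ k → ConsecutiveCoprime (2 + k) → ConsecutiveCoprime (3 + k)
  consecutiveCoprime-step k coprime-before {x} {y} dx dy x∈S' y∈S' {s} s-prime s∣x s∣y
    with predecessors k dy y∈S'
  ... | _ , z , _ , dz , _ , z∈S' =
    [ (λ s∣b → b-noCommonPrime x∈S' s-prime s∣b s∣x)
    , (λ s∣z → coprime-before dz dx z∈S' x∈S' s-prime s∣z s∣x)
    ]′ (euclidsLemmaℤ b (+ z) s-prime s∣bz)
    where
    s∣bz : + s ∣ℤ b ℤ.* + z
    s∣bz = to (∣-+-⇔ʳ (a ℤ.* + x) (b ℤ.* + z) (recurrence k dy y∈S' dx dz) (∣ℤn⇒∣ℤm*n a (+ x) s∣x))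
              s∣y

  consecutiveCoprime : ∀ i → ConsecutiveCoprime i
  consecutiveCoprime 0 dx _ x∈S' _ = contradiction (InS'⇒index≥2 dx x∈S') λ ()
  consecutiveCoprime 1 dx _ x∈S' _ = contradiction (InS'⇒index≥2 dx x∈S') λ { (s≤s ()) }
  consecutiveCoprime 2 dx dy _ _ s-prime s∣x s∣y with IsDiv-unique dx d₂ | IsDiv-unique dy d₃
  ... | refl | refl = p∤q (subst (_∣ q) (prime∣prime⇒≡ s-prime p-prime s∣x) s∣y)
  consecutiveCoprime (suc (suc (suc k))) = consecutiveCoprime-step k (consecutiveCoprime (suc (suc k)))

  p²≡[a²+b]q+[ab]p : + (p * p) ≡ (a ℤ.* a ℤ.+ b) ℤ.* + q ℤ.+ (a ℤ.* b) ℤ.* + p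
  p²≡[a²+b]q+[ab]p = second-order-recurrence a b (+ q) (+ p) p²≡ar+bq r≡aq+bp

  p∣a²+b : + p ∣ℤ a ℤ.* a ℤ.+ b
  p∣a²+b = [ id , ⊥-elim ∘ p∤q ]′ (euclidsLemmaℤ (a ℤ.* a ℤ.+ b) (+ q) p-prime p∣[a²+b]q)
    where
    p∣[a²+b]q : + p ∣ℤ (a ℤ.* a ℤ.+ b) ℤ.* + q
    p∣[a²+b]q = to (∣-+-⇔ˡ ((a ℤ.* a ℤ.+ b) ℤ.* + q) ((a ℤ.* b) ℤ.* + p) p²≡[a²+b]q+[ab]p
                           (∣ℤn⇒∣ℤm*n (a ℤ.* b) (+ p) ∣-refl))
                   (m∣m*n p)

  p∤ab : ¬ + p ∣ℤ a ℤ.* b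
  p∤ab = [ p∤a , p∤b ]′ ∘ euclidsLemmaℤ a b p-prime

  PDividesIff : ℕ → Set
  PDividesIff i = ∀ {x} → IsDiv N i x → InS' N x → (p ∣ x ⇔ i % 3 ≡ 2)

  pDividesIff-step : ∀ k → PDividesIff (2 + k) → PDividesIff (5 + k)
  pDividesIff-step k iff-before {x} dx x∈S' =
    let z , w , dw , w∈S' , x≡[a²+b]z+[ab]w = recurrence₂ k dx x∈S' in begin
      (p ∣ x)                     ∼⟨ ∣-+-⇔ʳ ((a ℤ.* a ℤ.+ b) ℤ.* + z) ((a ℤ.* b) ℤ.* + w) x≡[a²+b]z+[ab]w
                                             (∣ℤm⇒∣ℤm*n (a ℤ.* a ℤ.+ b) (+ z) p∣a²+b) ⟩
      (+ p ∣ℤ (a ℤ.* b) ℤ.* + w)  ∼⟨ prime∤⇒∣ℤm*n⇔∣ℤn (a ℤ.* b) (+ w) p-prime p∤ab ⟩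
      (p ∣ w)                     ∼⟨ iff-before dw w∈S' ⟩
      ((2 + k) % 3 ≡ 2)           ≡⟨ cong (_≡ 2) ([3+n]%3≡n%3 (2 + k)) ⟨
      ((5 + k) % 3 ≡ 2)           ∎
    where open Related.EquationalReasoning {k = Related.equivalence}

  pDividesIff : ∀ i → PDividesIff i
  pDividesIff 0 dx x∈S' = contradiction (InS'⇒index≥2 dx x∈S') λ ()
  pDividesIff 1 dx x∈S' = contradiction (InS'⇒index≥2 dx x∈S') λ { (s≤s ()) }
  pDividesIff 2 dx _ rewrite IsDiv-unique dx d₂ = mk⇔ (const refl) (const ∣-refl)
  pDividesIff 3 dx _ rewrite IsDiv-unique dx d₃ = mk⇔ (⊥-elim ∘ p∤q) λ ()
  pDividesIff 4 dx _ rewrite IsDiv-unique dx d₄ = mk⇔ (⊥-elim ∘ p∤r) λ ()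
  pDividesIff (suc (suc (suc (suc (suc k))))) = pDividesIff-step k (pDividesIff (suc (suc k)))

lemma2p4 : (p q r N : ℕ) (a b : ℤ) →
    Prime p → Prime q → Prime r → p < q → q < r → 1 < N →
    IsDiv N 2 p → IsDiv N 3 q → IsDiv N 4 r → IsDiv N 5 (p * p) →
    InS' N p → InS' N q → InS' N r → InS' N (p * p) →
    SmallRecurrent N p q a b →
    (gcdℤ a b ≡ + 1 × ¬ ((+ p) ∣ℤ a))
    × (∀ i x → IsDiv N i x → InS' N x → gcd ∣ b ∣ x ≡ 1)
    × (∀ i x y → IsDiv N i x → IsDiv N (suc i) y → InS' N x → InS' N y → gcd x y ≡ 1)
    × (∀ i x → IsDiv N i x → InS' N x → (p ∣ x ⇔ i % 3 ≡ 2))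
lemma2p4 p q r N a b p-prime q-prime r-prime p<q q<r _ d₂ d₃ d₄ d₅ _ _ r∈S' p²∈S' small-recurrent =
    (cong +_ (noCommonPrime⇒gcd≡1 a-b-noCommonPrime) , p∤a)
  , (λ _ _ _ x∈S' → noCommonPrime⇒gcd≡1 (b-noCommonPrime x∈S'))
  , (λ i _ _ dx dy x∈S' y∈S' → noCommonPrime⇒gcd≡1 (consecutiveCoprime i dx dy x∈S' y∈S'))
  , (λ i _ → pDividesIff i)
  where
  open SmallRecurrence {a = a} {b} p-prime q-prime r-prime p<q q<r d₂ d₃ d₄ d₅ r∈S' p²∈S' small-recurrent
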